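{- Let $t\ge 3$ be an odd integer, $S=(1,1,2,2)$, and $n=2(t+2)m$ with $m$ a positive integer. Then $\chi_S(C_n(2,t))=4$.
   Context: For integers $n$ and $s_1,\ldots,s_k$, the circulant graph $C_n(s_1,\ldots,s_k)$ has vertex set $\{0,1,\ldots,n-1\}$, and each vertex $i$ is adjacent to $i+s_j \pmod n$ (and hence to $i-s_j\pmod n$) for every $j$. For a graph $G$ and a non-decreasing sequence $S=(a_1,a_2,\ldots)$ of positive integers, an $S$-packing $k$-coloring of $G$ is a map $f:V(G)\to\{1,\ldots,k\}$ (with $k$ at most the length of $S$ when $S$ is finite) such that any two distinct vertices $u,v$ with $f(u)=f(v)=i$ satisfy $d_G(u,v)>a_i$, where $d_G$ is the shortest-path distance; $\chi_S(G)$ is the smallest such $k$. -}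

module Defs where

open import Data.Nat using (ℕ; zero; suc; _+_; _*_; _≤_; _<_)
open import Data.Fin using (Fin; toℕ)
open import Data.Vec using (Vec; lookup)
open import Data.List using (List)
open import Data.List.Membership.Propositional using (_∈_)
open import Data.Product using (Σ; ∃; _×_; _,_)
open import Data.Sum using (_⊎_)
open import Relation.Binary.PropositionalEquality using (_≡_; _≢_)
open import Relation.Nullary using (¬_)

record Graph : Set₁ where
  field
    V   : Set
    Adj : V → V → Set
open Graph public

-- Congruence  ModEq n a b  means a ≡ b (mod n)  on naturals, witnessed by explicit multiples of n
-- (avoids needing NonZero n).
ModEq : ℕ → ℕ → ℕ → Set
ModEq n a b = ∃ λ q → ∃ λ r → a + q * n ≡ b + r * n

Circulant : (n : ℕ) → List ℕ → Graph
Circulant n ss = record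
  { V   = Fin n
  ; Adj = λ i j → ∃ λ s → s ∈ ss ×
            (ModEq n (toℕ i + s) (toℕ j) ⊎ ModEq n (toℕ j + s) (toℕ i))
  }

data Walk (G : Graph) : V G → V G → ℕ → Set where
  here : ∀ {u} → Walk G u u zero
  step : ∀ {u w v ℓ} → Adj G u w → Walk G w v ℓ → Walk G u v (suc ℓ)

-- Shortest-path distance d_G(u,v) > a  (i.e. no walk of length ≤ a; includes d = ∞).
DistGt : (G : Graph) → V G → V G → ℕ → Set
DistGt G u v a = ∀ ℓ → ℓ ≤ a → ¬ Walk G u v ℓ

-- S-packing k-coloring for a finite sequence S = (a_1,...,a_L) (non-decreasing),
-- with k ≤ L: colour c ∈ Fin L (0-indexed: colour c+1 of the paper), only colours < k used.
IsSPackingColoring : ∀ {L} (S : Vec ℕ L) (G : Graph) (k : ℕ) → (V G → Fin L) → Set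
IsSPackingColoring S G k f =
  (∀ v → toℕ (f v) < k) ×
  (∀ u v → u ≢ v → f u ≡ f v → DistGt G u v (lookup S (f u)))

HasSPackingColoring : ∀ {L} (S : Vec ℕ L) (G : Graph) (k : ℕ) → Set
HasSPackingColoring {L} S G k = k ≤ L × Σ (V G → Fin L) (IsSPackingColoring S G k)

ChiS≡ : ∀ {L} (S : Vec ℕ L) (G : Graph) (k : ℕ) → Set
ChiS≡ S G k = HasSPackingColoring S G k × (∀ j → j < k → ¬ HasSPackingColoring S G j)

-- With T = t + 2, the level map R x = x (t + 3)/2 mod T is well defined on ℤ_n since
-- T ∣ n, and it sends the steps ±2 to ±1 and ±t to ∓1, so adjacent vertices lie on cyclically
-- adjacent levels.  Colour the levels 0, …, T - 2 alternately 1, 2 and split the last level into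
-- colours 3, 4 by the parity of x: a walk of length two from that level back to it either retraces
-- an edge or changes the parity of x.  In a packing colouring with colours (1, 1, 2), the vertices not of colour 3 are
-- properly 2-coloured along edges.  A vertex x + 2 of colour 3 can be bypassed through the ladder
-- x, x + t, x + t + 2, x + t + 4, x + 4 without changing parity, so the colours alternate along the
-- rails x, x + 2, x + 4, …; but two rails joined by two rungs close a walk of odd length t + 2.
module Submission where

open import Defs
open import Data.Nat using (ℕ; zero; suc; _+_; _*_; _≤_; _<_; z≤n; s≤s; s≤s⁻¹; NonZero; _%_; _/_; _≟_)
open import Data.Nat.Properties
  using ( +-commutativeSemigroup; *-commutativeSemigroup; +-assoc; +-comm; +-suc; +-identityʳ
        ; +-cancelˡ-≡; +-cancelʳ-≡; *-assoc; *-suc; *-distribʳ-+; *-cancelˡ-≡; *-monoʳ-≤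
        ; ≤-refl; ≤-reflexive; ≤-trans; <-trans; ≤-<-trans; <-≤-trans; <⇒≱; ≤∧≢⇒<
        ; n≤1+n; n<1+n; m≤m+n; m≤n+m; m<m+n; m≤m*n )
open import Algebra.Properties.CommutativeSemigroup +-commutativeSemigroup using (xy∙z≈xz∙y)
open import Algebra.Properties.CommutativeSemigroup *-commutativeSemigroup
  using () renaming (xy∙z≈xz∙y to *-right-comm)
open import Data.Nat.DivMod using (_mod_; m%n<n; m≡m%n+[m/n]*n; [m+kn]%n≡m%n; m<n⇒m%n≡m; m%n%n≡m%n)
open import Data.Nat.Divisibility
  using (_∣_; divides; ∣-refl; ∣m∣n⇒∣m+n; m∣m*n; ∣m+n∣m⇒∣n; ∣⇒≤; m*n∣⇒m∣; m*n∣⇒n∣)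
open import Data.Nat.Tactic.RingSolver using (solve-∀)
open import Data.Fin using (Fin; zero; suc; toℕ; _↑ˡ_)
open import Data.Fin.Properties
  using (toℕ-fromℕ<; toℕ<n; toℕ-injective; suc-injective; ↑ˡ-injective) renaming (_≟_ to _≟ᶠ_)
open import Data.List using (List; _∷_; [])
open import Data.List.Membership.Propositional using (_∈_)
open import Data.List.Relation.Unary.Any using (here; there)
open import Data.Product using (∃; _×_; _,_)
open import Data.Sum using (_⊎_; inj₁; inj₂; [_,_]′)
open import Data.Vec using (Vec; _∷_; []; lookup)
open import Data.Bool using (Bool; true; false; not)
open import Data.Bool.Properties using (not-involutive; not-¬)
open import Data.Nat.GeneralisedArithmetic using (fold; fold-+)
open import Data.Empty using (⊥; ⊥-elim)
open import Relation.Nullary using (¬_; Dec; yes; no)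
open import Relation.Binary.PropositionalEquality

S : Vec ℕ 4
S = 1 ∷ 1 ∷ 2 ∷ 2 ∷ []

module _ {n : ℕ} where

  ModEq-refl : ∀ {a} → ModEq n a a
  ModEq-refl = 0 , 0 , refl

  ModEq-sym : ∀ {a b} → ModEq n a b → ModEq n b a
  ModEq-sym (q , r , e) = r , q , sym e

  ModEq-trans : ∀ {a b c} → ModEq n a b → ModEq n b c → ModEq n a c
  ModEq-trans {a} {b} {c} (q₁ , r₁ , e₁) (q₂ , r₂ , e₂) = q₁ + q₂ , r₂ + r₁ , (begin
      a + (q₁ + q₂) * n     ≡⟨ split a q₁ q₂ ⟩
      a + q₁ * n + q₂ * n   ≡⟨ cong (_+ q₂ * n) e₁ ⟩
      b + r₁ * n + q₂ * n   ≡⟨ xy∙z≈xz∙y b _ _ ⟩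
      b + q₂ * n + r₁ * n   ≡⟨ cong (_+ r₁ * n) e₂ ⟩
      c + r₂ * n + r₁ * n   ≡⟨ split c r₂ r₁ ⟨
      c + (r₂ + r₁) * n     ∎)
    where
      open ≡-Reasoning
      split : ∀ x p q → x + (p + q) * n ≡ x + p * n + q * n
      split x p q = trans (cong (x +_) (*-distribʳ-+ n p q)) (sym (+-assoc x _ _))

  ModEq-suc : ∀ {a b} → ModEq n a b → ModEq n (suc a) (suc b)
  ModEq-suc (q , r , e) = q , r , cong suc e

  ModEq-+ʳ : ∀ {a b} c → ModEq n a b → ModEq n (a + c) (b + c)
  ModEq-+ʳ {a} {b} c (q , r , e) = q , r ,
    trans (xy∙z≈xz∙y a c _) (trans (cong (_+ c) e) (xy∙z≈xz∙y b _ c))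

  ModEq-+ʳ-cancel : ∀ {a b} c → ModEq n (a + c) (b + c) → ModEq n a b
  ModEq-+ʳ-cancel {a} {b} c (q , r , e) = q , r ,
    +-cancelʳ-≡ c _ _ (trans (xy∙z≈xz∙y a _ c) (trans e (xy∙z≈xz∙y b c _)))

  ModEq-*ʳ : ∀ {a b} c → ModEq n a b → ModEq n (a * c) (b * c)
  ModEq-*ʳ {a} {b} c (q , r , e) = q * c , r * c ,
    trans (distrib a q) (trans (cong (_* c) e) (sym (distrib b r)))
    where
      distrib : ∀ x p → x * c + p * c * n ≡ (x + p * n) * c
      distrib x p = trans (cong (x * c +_) (*-right-comm p c n)) (sym (*-distribʳ-+ c x (p * n)))

  ModEq-+* : ∀ a j → ModEq n (a + j * n) a
  ModEq-+* a j = 0 , j , +-identityʳ (a + j * n)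

  ModEq-∣ : ∀ {d a b} → d ∣ n → ModEq n a b → ModEq d a b
  ModEq-∣ {d} {a} {b} (divides j n≡jd) (q , r , e) = q * j , r * j ,
    trans (cong (a +_) (rescale q)) (trans e (cong (b +_) (sym (rescale r))))
    where
      rescale : ∀ p → p * j * d ≡ p * n
      rescale p = trans (*-assoc p j d) (cong (p *_) (sym n≡jd))

  ModEq[m+d]m⇒∣d : ∀ {a d} → ModEq n (a + d) a → n ∣ d
  ModEq[m+d]m⇒∣d {a} {d} (q , r , e) = ∣m+n∣m⇒∣n (divides r (+-cancelˡ-≡ a _ _ shifted)) (divides q refl)
    where
      shifted : a + (q * n + d) ≡ a + r * n
      shifted = trans (cong (a +_) (+-comm (q * n) d)) (trans (sym (+-assoc a d _)) e)

  module _ {{_ : NonZero n}} where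

    ModEq⇒%≡ : ∀ {a b} → ModEq n a b → a % n ≡ b % n
    ModEq⇒%≡ {a} {b} (q , r , e) =
      trans (sym ([m+kn]%n≡m%n a q n)) (trans (cong (_% n) e) ([m+kn]%n≡m%n b r n))

    %≡⇒ModEq : ∀ {a b} → a % n ≡ b % n → ModEq n a b
    %≡⇒ModEq {a} {b} e = b / n , a / n , (begin
        a + b / n * n                  ≡⟨ cong (_+ b / n * n) (m≡m%n+[m/n]*n a n) ⟩
        a % n + a / n * n + b / n * n  ≡⟨ cong (λ z → z + a / n * n + b / n * n) e ⟩
        b % n + a / n * n + b / n * n  ≡⟨ xy∙z≈xz∙y (b % n) _ _ ⟩
        b % n + b / n * n + a / n * n  ≡⟨ cong (_+ a / n * n) (m≡m%n+[m/n]*n b n) ⟨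
        b + a / n * n                  ∎)
      where open ≡-Reasoning

    ModEq-%ˡ : ∀ a → ModEq n (a % n) a
    ModEq-%ˡ a = %≡⇒ModEq (m%n%n≡m%n a n)

    ModEq-<⇒≡ : ∀ {a b} → a < n → b < n → ModEq n a b → a ≡ b
    ModEq-<⇒≡ a<n b<n e = trans (sym (m<n⇒m%n≡m a<n)) (trans (ModEq⇒%≡ e) (m<n⇒m%n≡m b<n))

    ModEq-toℕ-mod : ∀ x → ModEq n (toℕ (x mod n)) x
    ModEq-toℕ-mod x = subst (λ z → ModEq n z x) (sym (toℕ-fromℕ< _)) (ModEq-%ˡ x)

    mod≡⇒ModEq : ∀ {x y} → x mod n ≡ y mod n → ModEq n x y
    mod≡⇒ModEq {x} {y} eq = %≡⇒ModEq (begin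
      x % n                ≡⟨ toℕ-fromℕ< _ ⟨
      toℕ (x mod n)        ≡⟨ cong toℕ eq ⟩
      toℕ (y mod n)        ≡⟨ toℕ-fromℕ< _ ⟩
      y % n                ∎)
      where open ≡-Reasoning

    ModEq-+-absurd : ∀ {a d} → 0 < d → d < n → ¬ ModEq n (a + d) a
    ModEq-+-absurd {d = suc _} _ d<n e = <⇒≱ d<n (∣⇒≤ (ModEq[m+d]m⇒∣d e))

    mod-≢ : ∀ {x y d} → 0 < d → d < n → x + d ≡ y → x mod n ≢ y mod n
    mod-≢ 0<d d<n refl eq = ModEq-+-absurd 0<d d<n (ModEq-sym (mod≡⇒ModEq eq))

module _ {G : Graph} where

  distGt₁ : ∀ {u v} → u ≢ v → ¬ Adj G u v → DistGt G u v 1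
  distGt₁ u≢v _    zero          _         here           = u≢v refl
  distGt₁ _   ¬u~v (suc zero)    _         (step u~v here) = ¬u~v u~v
  distGt₁ _   _    (suc (suc _)) (s≤s ()) _

  distGt₂ : ∀ {u v} → u ≢ v → ¬ Adj G u v → (∀ {w} → Adj G u w → ¬ Adj G w v) → DistGt G u v 2
  distGt₂ u≢v _    _     zero                _               here                       = u≢v refl
  distGt₂ _   ¬u~v _     (suc zero)          _               (step u~v here)            = ¬u~v u~v
  distGt₂ _   _    ¬u~~v (suc (suc zero))    _               (step u~w (step w~v here)) = ¬u~~v u~w w~v
  distGt₂ _   _    _     (suc (suc (suc _))) (s≤s (s≤s ())) _

module _ {n : ℕ} {ss : List ℕ} where

  Circulant-sym : ∀ {u v} → Adj (Circulant n ss) u v → Adj (Circulant n ss) v u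
  Circulant-sym (s , s∈ss , inj₁ e) = s , s∈ss , inj₂ e
  Circulant-sym (s , s∈ss , inj₂ e) = s , s∈ss , inj₁ e

  mod-adjacent : ∀ {x y s} {{_ : NonZero n}} → s ∈ ss → x + s ≡ y → Adj (Circulant n ss) (x mod n) (y mod n)
  mod-adjacent {x} {s = s} s∈ss refl = s , s∈ss ,
    inj₁ (ModEq-trans (ModEq-+ʳ s (ModEq-toℕ-mod x)) (ModEq-sym (ModEq-toℕ-mod (x + s))))

module UpperBound (k n : ℕ) {{_ : NonZero n}} (2T∣n : 2 * (suc (2 * k) + 2) ∣ n) where

  t T I : ℕ
  t = suc (2 * k)
  T = t + 2
  I = suc (suc k)

  G : Graph
  G = Circulant n (2 ∷ t ∷ [])

  2<T : 2 < T
  2<T = s≤s (m≤n+m 2 (2 * k))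

  opaque
    R : ℕ → ℕ
    R x = x * I % T

    R<T : ∀ x → R x < T
    R<T x = m%n<n (x * I) T

    R-cong : ∀ {x y} → ModEq n x y → R x ≡ R y
    R-cong e = ModEq⇒%≡ (ModEq-*ʳ I (ModEq-∣ (m*n∣⇒n∣ 2 T 2T∣n) e))

    ModEq-R : ∀ x → ModEq T (x * I) (R x)
    ModEq-R x = ModEq-sym (ModEq-%ˡ (x * I))

  infix 4 _↝_
  _↝_ : ℕ → ℕ → Set
  x ↝ y = ModEq T (suc (R x)) (R y)

  ↝-cong : ∀ {x x′ y y′} → ModEq n x x′ → ModEq n y y′ → x ↝ y → x′ ↝ y′
  ↝-cong ex ey x↝y = subst₂ (λ a b → ModEq T (suc a) b) (R-cong ex) (R-cong ey) x↝y

  -- I is the inverse of 2 modulo T, so R takes the steps 2 and t = T - 2 to +1 and -1.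
  +2-↝ : ∀ x → x ↝ x + 2
  +2-↝ x = ModEq-trans (ModEq-suc (ModEq-sym (ModEq-R x)))
             (ModEq-trans (1 , 0 , identity x k) (ModEq-R (x + 2)))
    where
      identity : ∀ x j → suc (x * suc (suc j)) + 1 * (suc (2 * j) + 2)
                       ≡ (x + 2) * suc (suc j) + 0 * (suc (2 * j) + 2)
      identity = solve-∀

  +t-↝ : ∀ x → x + t ↝ x
  +t-↝ x = ModEq-trans (ModEq-suc (ModEq-sym (ModEq-R (x + t))))
             (ModEq-trans (0 , suc k , identity x k) (ModEq-R x))
    where
      identity : ∀ x j → suc ((x + suc (2 * j)) * suc (suc j)) + 0 * (suc (2 * j) + 2)
                       ≡ x * suc (suc j) + suc j * (suc (2 * j) + 2)
      identity = solve-∀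

  data Step (x y : ℕ) : Set where
    up₂   : ModEq n (x + 2) y → Step x y
    down₂ : ModEq n (y + 2) x → Step x y
    upₜ   : ModEq n (x + t) y → Step x y
    downₜ : ModEq n (y + t) x → Step x y

  adj⇒Step : ∀ {u v} → Adj G u v → Step (toℕ u) (toℕ v)
  adj⇒Step (_ , here refl         , inj₁ e) = up₂ e
  adj⇒Step (_ , here refl         , inj₂ e) = down₂ e
  adj⇒Step (_ , there (here refl) , inj₁ e) = upₜ e
  adj⇒Step (_ , there (here refl) , inj₂ e) = downₜ e

  ↝-+2 : ∀ {x y} → ModEq n (x + 2) y → x ↝ y
  ↝-+2 {x} e = ↝-cong ModEq-refl e (+2-↝ x)

  ↝-+t : ∀ {x y} → ModEq n (x + t) y → y ↝ x
  ↝-+t {x} e = ↝-cong e ModEq-refl (+t-↝ x)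

  Step-↝ : ∀ {x y} → Step x y → x ↝ y ⊎ y ↝ x
  Step-↝ (up₂ e)   = inj₁ (↝-+2 e)
  Step-↝ (down₂ e) = inj₂ (↝-+2 e)
  Step-↝ (upₜ e)   = inj₂ (↝-+t e)
  Step-↝ (downₜ e) = inj₁ (↝-+t e)

  ↝-R-≢ : ∀ {x y} → x ↝ y → R x ≢ R y
  ↝-R-≢ {x} {y} x↝y Rx≡Ry = ModEq-+-absurd {a = R x} (s≤s z≤n) (<-trans (n<1+n 1) 2<T)
    (subst (ModEq T (R x + 1)) (sym Rx≡Ry) (subst (λ z → ModEq T z (R y)) (+-comm 1 (R x)) x↝y))

  ↝↝-R-≢ : ∀ {x c y} → x ↝ c → c ↝ y → R x ≢ R y
  ↝↝-R-≢ {x} {y = y} x↝c c↝y Rx≡Ry = ModEq-+-absurd {a = R x} (s≤s z≤n) 2<T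
    (subst (ModEq T (R x + 2)) (sym Rx≡Ry)
      (subst (λ z → ModEq T z (R y)) (+-comm 2 (R x)) (ModEq-trans (ModEq-suc x↝c) c↝y)))

  parity-+2 : ∀ {x y} → ModEq n (x + 2) y → ModEq 2 x y
  parity-+2 {x} e = ModEq-trans (ModEq-sym (ModEq-+* x 1)) (ModEq-∣ (m*n∣⇒m∣ 2 T 2T∣n) e)

  parity-+t : ∀ {x y} → ModEq n (x + t) y → ModEq 2 (suc x) y
  parity-+t {x} e = ModEq-trans (k , 0 , identity x k) (ModEq-∣ (m*n∣⇒m∣ 2 T 2T∣n) e)
    where
      identity : ∀ x j → suc x + j * 2 ≡ x + suc (2 * j) + 0 * 2
      identity = solve-∀

  opposite-parity : ∀ {x y} → ModEq 2 (suc x) y → ¬ ModEq 2 x y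
  opposite-parity {x} sx~y x~y = ModEq-+-absurd {a = x} (s≤s z≤n) (s≤s (s≤s z≤n))
    (subst (λ z → ModEq 2 z x) (+-comm 1 x) (ModEq-trans sx~y (ModEq-sym x~y)))

  -- A step moves R by ±1 and x by an even (±2) or odd (±t) amount, so a two-step walk that
  -- changes neither consists of a step and its reverse.
  two-step-returns : ∀ {x c y} → x < n → y < n → R x ≡ R y → ModEq 2 x y → Step x c → Step c y → x ≡ y
  two-step-returns x<n y<n _ _ (up₂ p)   (down₂ q) =
    ModEq-<⇒≡ x<n y<n (ModEq-+ʳ-cancel 2 (ModEq-trans p (ModEq-sym q)))
  two-step-returns x<n y<n _ _ (down₂ p) (up₂ q)   = ModEq-<⇒≡ x<n y<n (ModEq-trans (ModEq-sym p) q)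
  two-step-returns x<n y<n _ _ (upₜ p)   (downₜ q) =
    ModEq-<⇒≡ x<n y<n (ModEq-+ʳ-cancel t (ModEq-trans p (ModEq-sym q)))
  two-step-returns x<n y<n _ _ (downₜ p) (upₜ q)   = ModEq-<⇒≡ x<n y<n (ModEq-trans (ModEq-sym p) q)
  two-step-returns _ _ Rx≡Ry _ (up₂ p)   (up₂ q)   = ⊥-elim (↝↝-R-≢ (↝-+2 p) (↝-+2 q) Rx≡Ry)
  two-step-returns _ _ Rx≡Ry _ (up₂ p)   (downₜ q) = ⊥-elim (↝↝-R-≢ (↝-+2 p) (↝-+t q) Rx≡Ry)
  two-step-returns _ _ Rx≡Ry _ (downₜ p) (up₂ q)   = ⊥-elim (↝↝-R-≢ (↝-+t p) (↝-+2 q) Rx≡Ry)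
  two-step-returns _ _ Rx≡Ry _ (downₜ p) (downₜ q) = ⊥-elim (↝↝-R-≢ (↝-+t p) (↝-+t q) Rx≡Ry)
  two-step-returns _ _ Rx≡Ry _ (down₂ p) (down₂ q) = ⊥-elim (↝↝-R-≢ (↝-+2 q) (↝-+2 p) (sym Rx≡Ry))
  two-step-returns _ _ Rx≡Ry _ (down₂ p) (upₜ q)   = ⊥-elim (↝↝-R-≢ (↝-+t q) (↝-+2 p) (sym Rx≡Ry))
  two-step-returns _ _ Rx≡Ry _ (upₜ p)   (down₂ q) = ⊥-elim (↝↝-R-≢ (↝-+2 q) (↝-+t p) (sym Rx≡Ry))
  two-step-returns _ _ Rx≡Ry _ (upₜ p)   (upₜ q)   = ⊥-elim (↝↝-R-≢ (↝-+t q) (↝-+t p) (sym Rx≡Ry))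
  two-step-returns _ _ _ x~y (up₂ p)   (upₜ q)   =
    ⊥-elim (opposite-parity (ModEq-trans (ModEq-suc (parity-+2 p)) (parity-+t q)) x~y)
  two-step-returns _ _ _ x~y (upₜ p)   (up₂ q)   =
    ⊥-elim (opposite-parity (ModEq-trans (parity-+t p) (parity-+2 q)) x~y)
  two-step-returns _ _ _ x~y (down₂ p) (downₜ q) =
    ⊥-elim (opposite-parity (ModEq-trans (parity-+t q) (parity-+2 p)) (ModEq-sym x~y))
  two-step-returns _ _ _ x~y (downₜ p) (down₂ q) =
    ⊥-elim (opposite-parity (ModEq-trans (ModEq-suc (parity-+2 q)) (parity-+t p)) (ModEq-sym x~y))

  ↝-suc : ∀ {x y} → R x ≢ suc t → x ↝ y → R y ≡ suc (R x)
  ↝-suc {x} {y} Rx≢ x↝y =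
    sym (ModEq-<⇒≡ (subst (suc (R x) <_) (sym (+-comm t 2)) 1+Rx<2+t) (R<T y) x↝y)
    where
      1+Rx<2+t : suc (R x) < suc (suc t)
      1+Rx<2+t = s≤s (≤∧≢⇒< (s≤s⁻¹ (subst (R x <_) (+-comm t 2) (R<T x))) Rx≢)

  ordinary-far : ∀ {u v} → R (toℕ u) ≢ suc t → R (toℕ v) ≢ suc t →
                 ModEq 2 (R (toℕ u)) (R (toℕ v)) → u ≢ v → DistGt G u v 1
  ordinary-far Ru≢ Rv≢ Ru~Rv u≢v = distGt₁ u≢v λ u~v →
    [ ¬↝ Ru≢ Ru~Rv , ¬↝ Rv≢ (ModEq-sym Ru~Rv) ]′ (Step-↝ (adj⇒Step u~v))
    where
      ¬↝ : ∀ {x y} → R x ≢ suc t → ModEq 2 (R x) (R y) → ¬ x ↝ y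
      ¬↝ Rx≢ Rx~Ry x↝y = opposite-parity ModEq-refl (subst (ModEq 2 _) (↝-suc Rx≢ x↝y) Rx~Ry)

  special-far : ∀ {u v} → R (toℕ u) ≡ R (toℕ v) → ModEq 2 (toℕ u) (toℕ v) → u ≢ v → DistGt G u v 2
  special-far Ru≡Rv u~v u≢v = distGt₂ u≢v
    (λ u~v → [ (λ u↝v → ↝-R-≢ u↝v Ru≡Rv) , (λ v↝u → ↝-R-≢ v↝u (sym Ru≡Rv)) ]′
               (Step-↝ (adj⇒Step u~v)))
    (λ u~w w~v → u≢v (toℕ-injective
      (two-step-returns (toℕ<n _) (toℕ<n _) Ru≡Rv u~v (adj⇒Step u~w) (adj⇒Step w~v))))

  -- suc t = T - 1 is the level split by parity.
  colour : ℕ → Fin 4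
  colour x with R x ≟ suc t
  ... | yes _ = suc (suc (x mod 2))
  ... | no  _ = (R x mod 2) ↑ˡ 2

  lookup-↑ˡ : ∀ (j : Fin 2) → lookup S (j ↑ˡ 2) ≡ 1
  lookup-↑ˡ zero       = refl
  lookup-↑ˡ (suc zero) = refl

  lookup-suc-suc : ∀ (i : Fin 2) → lookup S (suc (suc i)) ≡ 2
  lookup-suc-suc zero       = refl
  lookup-suc-suc (suc zero) = refl

  ↑ˡ≢suc-suc : ∀ (j i : Fin 2) → j ↑ˡ 2 ≢ suc (suc i)
  ↑ˡ≢suc-suc zero       _ ()
  ↑ˡ≢suc-suc (suc zero) _ ()

  colour-packs : ∀ u v → u ≢ v → colour (toℕ u) ≡ colour (toℕ v) →
                 DistGt G u v (lookup S (colour (toℕ u)))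
  colour-packs u v u≢v eq with R (toℕ u) ≟ suc t | R (toℕ v) ≟ suc t
  ... | yes Ru | yes Rv = subst (DistGt G u v) (sym (lookup-suc-suc (toℕ u mod 2)))
                            (special-far (trans Ru (sym Rv))
                              (mod≡⇒ModEq (suc-injective (suc-injective eq))) u≢v)
  ... | no Ru  | no Rv  = subst (DistGt G u v) (sym (lookup-↑ˡ (R (toℕ u) mod 2)))
                            (ordinary-far Ru Rv (mod≡⇒ModEq (↑ˡ-injective 2 _ _ eq)) u≢v)
  ... | yes _  | no _   = ⊥-elim (↑ˡ≢suc-suc _ _ (sym eq))
  ... | no _   | yes _  = ⊥-elim (↑ˡ≢suc-suc _ _ eq)

  packing : HasSPackingColoring S G 4
  packing = ≤-refl , (λ u → colour (toℕ u)) , (λ u → toℕ<n (colour (toℕ u))) , colour-packs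

fold-not-even : ∀ (z : Bool) j → fold z not (2 * j) ≡ z
fold-not-even z zero    = refl
fold-not-even z (suc j) = begin
    fold z not (2 * suc j)          ≡⟨ cong (fold z not) (*-suc 2 j) ⟩
    not (not (fold z not (2 * j)))  ≡⟨ not-involutive _ ⟩
    fold z not (2 * j)              ≡⟨ fold-not-even z j ⟩
    z                               ∎
  where open ≡-Reasoning

crossing-gaps : ∀ {e o a c t} → e + 2 * a ≡ o + t → o + 2 * c ≡ e + t → a + c ≡ t
crossing-gaps {e} {o} {a} {c} {t} ea oc = *-cancelˡ-≡ (a + c) t 2 (+-cancelʳ-≡ (e + o) _ _ (begin
    2 * (a + c) + (e + o)      ≡⟨ regroup e o a c ⟩
    (e + 2 * a) + (o + 2 * c)  ≡⟨ cong₂ _+_ ea oc ⟩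
    (o + t) + (e + t)          ≡⟨ collect e o t ⟩
    2 * t + (e + o)            ∎))
  where
    open ≡-Reasoning
    regroup : ∀ e o a c → 2 * (a + c) + (e + o) ≡ (e + 2 * a) + (o + 2 * c)
    regroup = solve-∀
    collect : ∀ e o t → (o + t) + (e + t) ≡ 2 * t + (e + o)
    collect = solve-∀

isOne : Fin 4 → Bool
isOne (suc zero) = true
isOne _          = false

isOne-flips : ∀ {a c : Fin 4} → toℕ a < 3 → toℕ c < 3 →
              a ≢ suc (suc zero) → c ≢ suc (suc zero) → a ≢ c → isOne c ≡ not (isOne a)
isOne-flips {zero}                 {zero}                 _ _ _ _ a≢c = ⊥-elim (a≢c refl)
isOne-flips {zero}                 {suc zero}             _ _ _ _ _   = refl
isOne-flips {suc zero}             {zero}                 _ _ _ _ _   = refl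
isOne-flips {suc zero}             {suc zero}             _ _ _ _ a≢c = ⊥-elim (a≢c refl)
isOne-flips {suc (suc zero)}       {_}                    _ _ a≢ _ _  = ⊥-elim (a≢ refl)
isOne-flips {_}                    {suc (suc zero)}       _ _ _ c≢ _  = ⊥-elim (c≢ refl)
isOne-flips {suc (suc (suc zero))} {_}                    (s≤s (s≤s (s≤s ()))) _ _ _ _
isOne-flips {_}                    {suc (suc (suc zero))} _ (s≤s (s≤s (s≤s ()))) _ _ _

module LowerBound (h n : ℕ) {{_ : NonZero n}} (t+2<n : suc (2 * suc h) + 2 < n) where

  t : ℕ
  t = suc (2 * suc h)

  G : Graph
  G = Circulant n (2 ∷ t ∷ [])

  adjacent₂ : ∀ {x y} → x + 2 ≡ y → Adj G (x mod n) (y mod n)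
  adjacent₂ = mod-adjacent (here refl)

  adjacentₜ : ∀ {x y} → x + t ≡ y → Adj G (x mod n) (y mod n)
  adjacentₜ = mod-adjacent (there (here refl))

  distinct : ∀ {x y d} → 0 < d → d ≤ t + 2 → x + d ≡ y → x mod n ≢ y mod n
  distinct 0<d d≤t+2 = mod-≢ 0<d (≤-<-trans d≤t+2 t+2<n)

  module _ (f : Fin n → Fin 4) (f<3 : ∀ u → toℕ (f u) < 3)
           (packs : ∀ u v → u ≢ v → f u ≡ f v → DistGt G u v (lookup S (f u))) where

    -- The class of colour 3 (index 2), the only one with packing distance 2.
    Sparse : ℕ → Set
    Sparse x = f (x mod n) ≡ suc (suc zero)

    b : ℕ → Bool
    b x = isOne (f (x mod n))

    flips : ∀ {x y} → Adj G (x mod n) (y mod n) → x mod n ≢ y mod n →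
            ¬ Sparse x → ¬ Sparse y → b y ≡ not (b x)
    flips {x} {y} x~y x≢y nx ny = isOne-flips (f<3 _) (f<3 _) nx ny λ fx≡fy →
      packs (x mod n) (y mod n) x≢y fx≡fy 1 (1≤S (f (x mod n))) (step x~y here)
      where
        1≤S : ∀ c → 1 ≤ lookup S c
        1≤S zero                   = s≤s z≤n
        1≤S (suc zero)             = s≤s z≤n
        1≤S (suc (suc zero))       = s≤s z≤n
        1≤S (suc (suc (suc zero))) = s≤s z≤n

    flips₂ : ∀ {x y} → x + 2 ≡ y → ¬ Sparse x → ¬ Sparse y → b y ≡ not (b x)
    flips₂ e = flips (adjacent₂ e) (distinct (s≤s z≤n) (m≤n+m 2 t) e)

    flipsₜ : ∀ {x y} → x + t ≡ y → ¬ Sparse x → ¬ Sparse y → b y ≡ not (b x)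
    flipsₜ e = flips (adjacentₜ e) (distinct (s≤s z≤n) (m≤m+n t 2) e)

    sparse-ball : ∀ {x y ℓ} → Sparse x → x mod n ≢ y mod n → ℓ ≤ 2 → Walk G (x mod n) (y mod n) ℓ →
                  ¬ Sparse y
    sparse-ball sx x≢y ℓ≤2 walk sy =
      packs _ _ x≢y (trans sx (sym sy)) _ (subst (λ c → _ ≤ lookup S c) (sym sx) ℓ≤2) walk

    Sparse? : ∀ x → Dec (Sparse x)
    Sparse? x = f (x mod n) ≟ᶠ suc (suc zero)

    sparse-right : ∀ {x y} → x + 2 ≡ y → Sparse x → ¬ Sparse y
    sparse-right e sx =
      sparse-ball sx (distinct (s≤s z≤n) (m≤n+m 2 t) e) (s≤s z≤n) (step (adjacent₂ e) here)

    sparse-left : ∀ {x y} → x + 2 ≡ y → Sparse y → ¬ Sparse x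
    sparse-left e sy = sparse-ball sy (≢-sym (distinct (s≤s z≤n) (m≤n+m 2 t) e)) (s≤s z≤n)
                         (step (Circulant-sym (adjacent₂ e)) here)

    t∸2≤t+2 : suc (2 * h) ≤ t + 2
    t∸2≤t+2 = ≤-trans (s≤s (*-monoʳ-≤ 2 (n≤1+n h))) (m≤m+n t 2)

    +2+[t∸2] : ∀ x → x + 2 + suc (2 * h) ≡ x + t
    +2+[t∸2] x = trans (+-assoc x 2 _) (cong (λ d → x + suc d) (sym (*-suc 2 h)))

    detour : ∀ {x y z} → x + 2 ≡ y → y + 2 ≡ z → Sparse y → ¬ Sparse x → ¬ Sparse z → b z ≡ b x
    detour {x} refl refl sy nx nz = begin
        b (x + 2 + 2)              ≡⟨ not-involutive _ ⟨
        not (not (b (x + 2 + 2)))  ≡⟨ cong not (flipsₜ square nz n₃) ⟨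
        not (b (x + t + 2 + 2))    ≡⟨ cong not (flips₂ refl n₂ n₃) ⟩
        not (not (b (x + t + 2)))  ≡⟨ not-involutive _ ⟩
        b (x + t + 2)              ≡⟨ flips₂ refl n₁ n₂ ⟩
        not (b (x + t))            ≡⟨ cong not (flipsₜ refl nx n₁) ⟩
        not (not (b x))            ≡⟨ not-involutive _ ⟩
        b x                        ∎
      where
        open ≡-Reasoning
        square : x + 2 + 2 + t ≡ x + t + 2 + 2
        square = trans (xy∙z≈xz∙y (x + 2) 2 t) (cong (_+ 2) (xy∙z≈xz∙y x 2 t))
        n₁ : ¬ Sparse (x + t)
        n₁ = sparse-ball sy (distinct (s≤s z≤n) t∸2≤t+2 (+2+[t∸2] x)) (s≤s (s≤s z≤n))
               (step (Circulant-sym (adjacent₂ refl)) (step (adjacentₜ refl) here))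
        n₂ : ¬ Sparse (x + t + 2)
        n₂ = sparse-ball sy (distinct (s≤s z≤n) (m≤m+n t 2) (xy∙z≈xz∙y x 2 t)) (s≤s z≤n)
               (step (adjacentₜ (xy∙z≈xz∙y x 2 t)) here)
        n₃ : ¬ Sparse (x + t + 2 + 2)
        n₃ = sparse-ball sy (distinct (s≤s z≤n) ≤-refl diagonal) (s≤s (s≤s z≤n))
               (step (adjacent₂ refl) (step (adjacentₜ square) here))
          where
            diagonal : x + 2 + (t + 2) ≡ x + t + 2 + 2
            diagonal = trans (sym (+-assoc (x + 2) t 2)) (cong (_+ 2) (xy∙z≈xz∙y x 2 t))

    +2* : ∀ x i → x + 2 * i + 2 ≡ x + 2 * suc i
    +2* x i = trans (+-assoc x (2 * i) 2) (cong (x +_) (trans (+-comm (2 * i) 2) (sym (*-suc 2 i))))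

    rail : ∀ x i → ¬ Sparse x → ¬ Sparse (x + 2 * i) → b (x + 2 * i) ≡ fold (b x) not i
    rail x zero _ _ = cong b (+-identityʳ x)
    rail x (suc i) nx nx+2i+2 with Sparse? (x + 2 * i)
    rail x (suc i)       nx nx+2i+2 | no nx+2i =
      trans (flips₂ (+2* x i) nx+2i nx+2i+2) (cong not (rail x i nx nx+2i))
    rail x (suc zero)    nx _       | yes s    = ⊥-elim (nx (subst Sparse (+-identityʳ x) s))
    rail x (suc (suc i)) nx nx+2i+4 | yes s    = begin
        b (x + 2 * suc (suc i))  ≡⟨ detour (+2* x i) (+2* x (suc i)) s nx+2i nx+2i+4 ⟩
        b (x + 2 * i)            ≡⟨ rail x i nx nx+2i ⟩
        fold (b x) not i         ≡⟨ not-involutive _ ⟨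
        fold (b x) not (suc (suc i)) ∎
      where
        open ≡-Reasoning
        nx+2i : ¬ Sparse (x + 2 * i)
        nx+2i = sparse-left (+2* x i) s

    rail′ : ∀ {x y} i → x + 2 * i ≡ y → ¬ Sparse x → ¬ Sparse y → b y ≡ fold (b x) not i
    rail′ {x} i refl = rail x i

    rung : ∀ x → (¬ Sparse x × ¬ Sparse (x + t)) ⊎ (¬ Sparse (x + 2) × ¬ Sparse (x + 2 + t))
    rung x with Sparse? x | Sparse? (x + t)
    ... | no nx  | no nx+t = inj₁ (nx , nx+t)
    ... | yes sx | _       = inj₂ (sparse-right refl sx ,
      sparse-ball sx (distinct (s≤s z≤n) (≤-reflexive (+-comm 2 t)) (sym (+-assoc x 2 t))) (s≤s (s≤s z≤n))
        (step (adjacent₂ refl) (step (adjacentₜ refl) here)))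
    ... | no _   | yes sx+t = inj₂ (
      sparse-ball sx+t (≢-sym (distinct (s≤s z≤n) t∸2≤t+2 (+2+[t∸2] x))) (s≤s (s≤s z≤n))
        (step (Circulant-sym (adjacentₜ refl)) (step (adjacent₂ refl) here)) ,
      sparse-right (xy∙z≈xz∙y x t 2) sx+t)

    -- The rails from e to o + t and from o to e + t close up with two rungs into a walk of odd length t + 2.
    odd-cycle : ∀ e o a c → e + 2 * a ≡ o + t → o + 2 * c ≡ e + t →
                ¬ Sparse e → ¬ Sparse (e + t) → ¬ Sparse o → ¬ Sparse (o + t) → ⊥
    odd-cycle e o a c ea oc ne ne+t nₒ nₒ+t = not-¬ refl (sym (begin
        not (b e)                            ≡⟨ flipsₜ refl ne ne+t ⟨
        b (e + t)                            ≡⟨ rail′ c oc nₒ ne+t ⟩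
        fold (b o) not c                     ≡⟨ cong (λ z → fold z not c) bo ⟩
        fold (fold (b e) not (suc a)) not c  ≡⟨ fold-+ (b e) not c {suc a} ⟨
        fold (b e) not (c + suc a)           ≡⟨ cong (fold (b e) not) c+a+1≡2[h+2] ⟩
        fold (b e) not (2 * suc (suc h))     ≡⟨ fold-not-even (b e) (suc (suc h)) ⟩
        b e                                  ∎))
      where
        open ≡-Reasoning
        bo : b o ≡ not (fold (b e) not a)
        bo = begin
          b o                   ≡⟨ not-involutive _ ⟨
          not (not (b o))       ≡⟨ cong not (flipsₜ refl nₒ nₒ+t) ⟨
          not (b (o + t))       ≡⟨ cong not (rail′ a ea ne nₒ+t) ⟩
          not (fold (b e) not a) ∎
        c+a+1≡2[h+2] : c + suc a ≡ 2 * suc (suc h)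
        c+a+1≡2[h+2] = trans (+-suc c a)
          (trans (cong suc (trans (+-comm c a) (crossing-gaps {e} {o} {a} {c} ea oc))) (sym (*-suc 2 (suc h))))

    gap : ∀ x y z → x + 2 * y ≡ z + 3 → x + 2 * (h + y) ≡ z + t
    gap x y z eq = trans (regroup x y h) (trans (cong (2 * h +_) eq) (sym (regroup′ z h)))
      where
        regroup : ∀ x y h → x + 2 * (h + y) ≡ 2 * h + (x + 2 * y)
        regroup = solve-∀
        regroup′ : ∀ z h → z + suc (2 * suc h) ≡ 2 * h + (z + 3)
        regroup′ = solve-∀

    no-colouring : ⊥
    no-colouring with rung 0 | rung 1
    ... | inj₁ (n₀ , n₀₊ₜ) | inj₁ (n₁ , n₁₊ₜ) =
      odd-cycle 0 1 (h + 2) (h + 1) (gap 0 2 1 refl) (gap 1 1 0 refl) n₀ n₀₊ₜ n₁ n₁₊ₜ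
    ... | inj₂ (n₂ , n₂₊ₜ) | inj₁ (n₁ , n₁₊ₜ) =
      odd-cycle 2 1 (h + 1) (h + 2) (gap 2 1 1 refl) (gap 1 2 2 refl) n₂ n₂₊ₜ n₁ n₁₊ₜ
    ... | inj₁ (n₀ , n₀₊ₜ) | inj₂ (n₃ , n₃₊ₜ) =
      odd-cycle 0 3 (h + 3) (h + 0) (gap 0 3 3 refl) (gap 3 0 0 refl) n₀ n₀₊ₜ n₃ n₃₊ₜ
    ... | inj₂ (n₂ , n₂₊ₜ) | inj₂ (n₃ , n₃₊ₜ) =
      odd-cycle 2 3 (h + 2) (h + 1) (gap 2 2 3 refl) (gap 3 1 2 refl) n₂ n₂₊ₜ n₃ n₃₊ₜ

  no-packing-below-4 : ∀ j → j < 4 → ¬ HasSPackingColoring S G j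
  no-packing-below-4 j j<4 (_ , f , f<j , packs) = no-colouring f (λ u → <-≤-trans (f<j u) (s≤s⁻¹ j<4)) packs

¬2∣⇒odd : ∀ t → ¬ 2 ∣ t → ∃ λ k → t ≡ suc (2 * k)
¬2∣⇒odd zero          ¬2∣0 = ⊥-elim (¬2∣0 (divides 0 refl))
¬2∣⇒odd (suc zero)    _    = 0 , refl
¬2∣⇒odd (suc (suc t)) ¬2∣t+2 with ¬2∣⇒odd t (λ 2∣t → ¬2∣t+2 (∣m∣n⇒∣m+n ∣-refl 2∣t))
... | k , refl = suc k , cong suc (sym (*-suc 2 k))

corollary11 : (t m : ℕ) → 3 ≤ t → ¬ (2 ∣ t) → 1 ≤ m →
    ChiS≡ (1 ∷ 1 ∷ 2 ∷ 2 ∷ []) (Circulant (2 * (t + 2) * m) (2 ∷ t ∷ [])) 4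
corollary11 t zero _ _ ()
corollary11 t (suc m) 3≤t ¬2∣t _ with ¬2∣⇒odd t ¬2∣t
... | zero  , refl = ⊥-elim (<⇒≱ 3≤t (s≤s z≤n))
... | suc h , refl =
  UpperBound.packing (suc h) n (m∣m*n (suc m)) ,
  LowerBound.no-packing-below-4 h n (<-≤-trans (m<m+n (t + 2) (s≤s z≤n)) (m≤m*n (2 * (t + 2)) (suc m)))
  where
    n : ℕ
    n = 2 * (t + 2) * suc m
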